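{- Let $\varphi$ be an order type that can be written as a sum $\varphi=\sum_{i=0}^n\psi_i$ where $n\in\mathbb{N}$, $n\ge 2$, and for all $i\le n$ we have $\psi_i\neq 0$ and $\varphi\not\leqslant\psi_i$. Then $\varphi$ is transcendable.
   Context: Work in ZFC. For order types, $\varphi\leqslant\psi$ means an order of type $\varphi$ embeds in one of type $\psi$; $\varphi<\psi$ means $\varphi\leqslant\psi$ and not $\psi\leqslant\varphi$. $\sum_{i=0}^n\psi_i=\psi_0+\psi_1+\cdots+\psi_n$ is the finite ordered sum (copies placed left to right). The product $\psi\tau$ is the type of $\tau$ with each point replaced by a copy of $\psi$. A type $\varphi$ is transcendable if there are types $\psi<\varphi$ and $\tau<\varphi$ with $\varphi\leqslant\psi\tau$. -}

module Defs where

open import Level using (0ℓ)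
open import Data.Nat using (ℕ; zero; suc)
open import Data.Fin using (Fin; zero; suc)
open import Data.Empty using (⊥)
open import Data.Product using (Σ; _×_; _,_)
open import Function using (_∘_)
open import Relation.Nullary using (¬_)
open import Relation.Binary.Bundles using (StrictTotalOrder)
open import Data.Sum.Relation.Binary.LeftOrder using (⊎-<-strictTotalOrder)
open import Data.Product.Relation.Binary.Lex.Strict using (×-strictTotalOrder)

-- A (linear) order; its order type is its isomorphism class.
LO : Set₁
LO = StrictTotalOrder 0ℓ 0ℓ 0ℓ

module _ where
  open StrictTotalOrder renaming (Carrier to ∣_∣)

  _⩽_ : LO → LO → Set
  A ⩽ B = Σ (∣ A ∣ → ∣ B ∣) λ f → ∀ {x y} → _<_ A x y → _<_ B (f x) (f y)

  _⋖_ : LO → LO → Set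
  A ⋖ B = (A ⩽ B) × ¬ (B ⩽ A)

  _≅_ : LO → LO → Set
  A ≅ B = Σ (∣ A ∣ → ∣ B ∣) λ f → Σ (∣ B ∣ → ∣ A ∣) λ g →
            (∀ {x y} → _<_ A x y → _<_ B (f x) (f y)) ×
            (∀ {x y} → _<_ B x y → _<_ A (g x) (g y)) ×
            (∀ x → _≈_ A (g (f x)) x) ×
            (∀ y → _≈_ B (f (g y)) y)

  IsZero : LO → Set
  IsZero A = ¬ ∣ A ∣

_⊕_ : LO → LO → LO
A ⊕ B = ⊎-<-strictTotalOrder {d = 0ℓ} {e = 0ℓ} {f = 0ℓ} A B

OSum : (n : ℕ) → (Fin (suc n) → LO) → LO
OSum zero ψ = ψ zero
OSum (suc n) ψ = ψ zero ⊕ OSum n (ψ ∘ suc)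

-- product ψ τ : τ with each point replaced by a copy of ψ
-- (carrier τ × ψ, lexicographic with the τ-coordinate dominant)
_⊗_ : LO → LO → LO
ψ ⊗ τ = ×-strictTotalOrder τ ψ

Transcendable : LO → Set₁
Transcendable φ = Σ LO λ ψ → Σ LO λ τ → (ψ ⋖ φ) × (τ ⋖ φ) × (φ ⩽ (ψ ⊗ τ))

-- A greedy scan of the summands, dropping leading ones while φ still embeds in the rest,
-- splits φ as X + Y with X, Y nonempty and φ embedding in neither. If φ ⩽ X + 1 then
-- φ ⩽ X·2, and X < φ, 2 < φ (φ has three increasing points, one in each of ψ 0, ψ 1, ψ 2).
-- Otherwise φ ⩽ X + Y ⩽ Y·(X + 1), with Y < φ and X + 1 < φ, the latter since X + 1 ⩽ X + Y.
module Submission where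

open import Defs
open import Level using (0ℓ)
open import Axiom.ExcludedMiddle using (ExcludedMiddle)
open import Data.Nat using (ℕ; _≤_; zero; suc; s≤s; z≤n)
open import Data.Fin using (Fin; zero; suc)
open import Data.Fin.Properties using (<-strictTotalOrder)
open import Data.Product using (_,_)
open import Data.Sum using (inj₁; inj₂)
open import Data.Sum.Relation.Binary.LeftOrder using (₁∼₂; ₁∼₁; ₂∼₂)
import Data.Sum.Relation.Binary.Pointwise as Pointwise
open import Data.Empty using (⊥; ⊥-elim)
open import Function using (_∘_)
open import Relation.Nullary using (¬_; yes; no)
open import Relation.Nullary.Decidable using (decidable-stable)
open import Relation.Binary.PropositionalEquality using (refl)
open import Relation.Binary.Bundles using (StrictTotalOrder)

open StrictTotalOrder renaming (Carrier to ∣_∣)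

one : LO
one = <-strictTotalOrder 1

two : LO
two = one ⊕ one

one-irrefl : ∀ {x y : Fin 1} → ¬ _<_ one x y
one-irrefl {zero} {zero} ()

-- The orders are explicit throughout: _⩽_ unfolds to a Σ-type, from which they cannot be inferred.
⩽-trans : ∀ A B C → A ⩽ B → B ⩽ C → A ⩽ C
⩽-trans _ _ _ (f , f-mono) (g , g-mono) = g ∘ f , g-mono ∘ f-mono

infix 1 ⩽-trans
syntax ⩽-trans A B C p q = A ⩽⟨ p ⟩ B ⩽⟨ q ⟩ C

≅⇒⩽ : ∀ A B → A ≅ B → A ⩽ B
≅⇒⩽ _ _ (f , _ , f-mono , _) = f , f-mono

≅⇒⩾ : ∀ A B → A ≅ B → B ⩽ A
≅⇒⩾ _ _ (_ , g , _ , g-mono , _) = g , g-mono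

⩽-⊕ˡ : ∀ A B → A ⩽ (A ⊕ B)
⩽-⊕ˡ _ _ = inj₁ , ₁∼₁

⩽-⊕ʳ : ∀ A B → B ⩽ (A ⊕ B)
⩽-⊕ʳ _ _ = inj₂ , ₂∼₂

OSum-head : ∀ m (R : Fin (suc m) → LO) → ∣ R zero ∣ → ∣ OSum m R ∣
OSum-head zero    R x = x
OSum-head (suc m) R x = inj₁ x

⊕-one-⩽-⊕ : ∀ X Y → ∣ Y ∣ → (X ⊕ one) ⩽ (X ⊕ Y)
⊕-one-⩽-⊕ X Y y = f , f-mono
  where
  f : ∣ X ⊕ one ∣ → ∣ X ⊕ Y ∣
  f (inj₁ x) = inj₁ x
  f (inj₂ _) = inj₂ y
  f-mono : ∀ {a b} → _<_ (X ⊕ one) a b → _<_ (X ⊕ Y) (f a) (f b)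
  f-mono ₁∼₂     = ₁∼₂
  f-mono (₁∼₁ p) = ₁∼₁ p
  f-mono (₂∼₂ p) = ⊥-elim (one-irrefl p)

⊕-one-⩽-⊗-two : ∀ X → ∣ X ∣ → (X ⊕ one) ⩽ (X ⊗ two)
⊕-one-⩽-⊗-two X x₀ = f , f-mono
  where
  f : ∣ X ⊕ one ∣ → ∣ X ⊗ two ∣
  f (inj₁ x) = inj₁ zero , x
  f (inj₂ _) = inj₂ zero , x₀
  f-mono : ∀ {a b} → _<_ (X ⊕ one) a b → _<_ (X ⊗ two) (f a) (f b)
  f-mono ₁∼₂     = inj₁ ₁∼₂
  f-mono (₁∼₁ p) = inj₂ (Pointwise.inj₁ refl , p)
  f-mono (₂∼₂ p) = ⊥-elim (one-irrefl p)

⊕-⩽-⊗-⊕-one : ∀ X Y → ∣ Y ∣ → (X ⊕ Y) ⩽ (Y ⊗ (X ⊕ one))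
⊕-⩽-⊗-⊕-one X Y y₀ = f , f-mono
  where
  f : ∣ X ⊕ Y ∣ → ∣ Y ⊗ (X ⊕ one) ∣
  f (inj₁ x) = inj₁ x , y₀
  f (inj₂ y) = inj₂ zero , y
  f-mono : ∀ {a b} → _<_ (X ⊕ Y) a b → _<_ (Y ⊗ (X ⊕ one)) (f a) (f b)
  f-mono ₁∼₂     = inj₁ ₁∼₂
  f-mono (₁∼₁ p) = inj₁ (₁∼₁ p)
  f-mono (₂∼₂ p) = inj₂ (Pointwise.inj₂ refl , p)

two⩽ : ∀ A {a b : ∣ A ∣} → _<_ A a b → two ⩽ A
two⩽ A {a} {b} a<b = f , f-mono
  where
  f : ∣ two ∣ → ∣ A ∣
  f (inj₁ _) = a
  f (inj₂ _) = b
  f-mono : ∀ {u v} → _<_ two u v → _<_ A (f u) (f v)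
  f-mono ₁∼₂     = a<b
  f-mono (₁∼₁ p) = ⊥-elim (one-irrefl p)
  f-mono (₂∼₂ p) = ⊥-elim (one-irrefl p)

¬three⩽two : ∀ {u v w : ∣ two ∣} → _<_ two u v → _<_ two v w → ⊥
¬three⩽two ₁∼₂     (₂∼₂ p) = one-irrefl p
¬three⩽two (₁∼₁ p) _       = one-irrefl p
¬three⩽two (₂∼₂ p) _       = one-irrefl p

two⋖ : ∀ A {a b c : ∣ A ∣} → _<_ A a b → _<_ A b c → two ⋖ A
two⋖ A a<b b<c = two⩽ A a<b , λ { (f , f-mono) → ¬three⩽two (f-mono a<b) (f-mono b<c) }

two⋖OSum : ∀ n (ψ : Fin (suc (suc (suc n))) → LO) → (∀ i → ∣ ψ i ∣) →
  two ⋖ OSum (suc (suc n)) ψ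
two⋖OSum n ψ point =
  two⋖ (OSum (suc (suc n)) ψ)
       {a = inj₁ (point zero)} {b = inj₂ (inj₁ (point (suc zero)))}
       {c = inj₂ (inj₂ (OSum-head n (λ i → ψ (suc (suc i))) (point (suc (suc zero)))))}
       ₁∼₂ (₂∼₂ ₁∼₂)

⋖-respʳ-≅ : ∀ A B C → A ⋖ B → C ≅ B → A ⋖ C
⋖-respʳ-≅ A B C (A⩽B , B⋠A) C≅B =
  (A ⩽⟨ A⩽B ⟩ B ⩽⟨ ≅⇒⩾ C B C≅B ⟩ C) ,
  λ C⩽A → B⋠A (B ⩽⟨ ≅⇒⩾ C B C≅B ⟩ C ⩽⟨ C⩽A ⟩ A)

record Decomposition (φ : LO) : Set₁ where
  field
    X Y  : LO
    x    : ∣ X ∣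
    y    : ∣ Y ∣
    φ⩽   : φ ⩽ (X ⊕ Y)
    ⩽φ   : (X ⊕ Y) ⩽ φ
    φ⋠X  : ¬ φ ⩽ X
    φ⋠Y  : ¬ φ ⩽ Y

decompose : ExcludedMiddle 0ℓ → ∀ φ m (R : Fin (suc (suc m)) → LO) →
  φ ⩽ OSum (suc m) R → OSum (suc m) R ⩽ φ →
  (∀ i → ∣ R i ∣) → (∀ i → ¬ φ ⩽ R i) → Decomposition φ
decompose em φ zero R φ⩽ ⩽φ r φ⋠R =
  record { X = R zero ; Y = R (suc zero) ; x = r zero ; y = r (suc zero)
         ; φ⩽ = φ⩽ ; ⩽φ = ⩽φ ; φ⋠X = φ⋠R zero ; φ⋠Y = φ⋠R (suc zero) }
decompose em φ (suc m) R φ⩽ ⩽φ r φ⋠R with em {φ ⩽ OSum (suc m) (R ∘ suc)}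
... | yes φ⩽tail = decompose em φ m (R ∘ suc) φ⩽tail tail⩽φ (r ∘ suc) (φ⋠R ∘ suc)
  where
  tail⩽φ : OSum (suc m) (R ∘ suc) ⩽ φ
  tail⩽φ = OSum (suc m) (R ∘ suc) ⩽⟨ ⩽-⊕ʳ (R zero) (OSum (suc m) (R ∘ suc)) ⟩
           OSum (suc (suc m)) R   ⩽⟨ ⩽φ ⟩ φ
... | no  φ⋠tail =
  record { X = R zero ; Y = OSum (suc m) (R ∘ suc)
         ; x = r zero ; y = OSum-head (suc m) (R ∘ suc) (r (suc zero))
         ; φ⩽ = φ⩽ ; ⩽φ = ⩽φ ; φ⋠X = φ⋠R zero ; φ⋠Y = φ⋠tail }

Decomposition⇒Transcendable : ExcludedMiddle 0ℓ → ∀ φ →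
  two ⋖ φ → Decomposition φ → Transcendable φ
Decomposition⇒Transcendable em φ two⋖φ
  record { X = X ; Y = Y ; x = x ; y = y ; φ⩽ = φ⩽ ; ⩽φ = ⩽φ ; φ⋠X = φ⋠X ; φ⋠Y = φ⋠Y }
  with em {φ ⩽ (X ⊕ one)}
... | yes φ⩽X+1 = X , two , (X⩽φ , φ⋠X) , two⋖φ ,
                  (φ ⩽⟨ φ⩽X+1 ⟩ X ⊕ one ⩽⟨ ⊕-one-⩽-⊗-two X x ⟩ X ⊗ two)
  where
  X⩽φ : X ⩽ φ
  X⩽φ = X ⩽⟨ ⩽-⊕ˡ X Y ⟩ X ⊕ Y ⩽⟨ ⩽φ ⟩ φ
... | no  φ⋠X+1 = Y , X ⊕ one , (Y⩽φ , φ⋠Y) , (X+1⩽φ , φ⋠X+1) ,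
                  (φ ⩽⟨ φ⩽ ⟩ X ⊕ Y ⩽⟨ ⊕-⩽-⊗-⊕-one X Y y ⟩ Y ⊗ (X ⊕ one))
  where
  Y⩽φ : Y ⩽ φ
  Y⩽φ = Y ⩽⟨ ⩽-⊕ʳ X Y ⟩ X ⊕ Y ⩽⟨ ⩽φ ⟩ φ
  X+1⩽φ : (X ⊕ one) ⩽ φ
  X+1⩽φ = X ⊕ one ⩽⟨ ⊕-one-⩽-⊕ X Y y ⟩ X ⊕ Y ⩽⟨ ⩽φ ⟩ φ

corollary5p3 : ExcludedMiddle 0ℓ →
    (φ : LO) (n : ℕ) (ψ : Fin (Data.Nat.suc n) → LO) →
    2 ≤ n →
    φ ≅ OSum n ψ →
    (∀ i → ¬ IsZero (ψ i)) →
    (∀ i → ¬ (φ ⩽ ψ i)) →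
    Transcendable φ
corollary5p3 em φ (suc (suc n)) ψ (s≤s (s≤s z≤n)) φ≅Σψ ψ≢0 φ⋠ψ =
  Decomposition⇒Transcendable em φ
    (⋖-respʳ-≅ two Σψ φ (two⋖OSum n ψ point) φ≅Σψ)
    (decompose em φ (suc n) ψ (≅⇒⩽ φ Σψ φ≅Σψ) (≅⇒⩾ φ Σψ φ≅Σψ) point φ⋠ψ)
  where
  Σψ : LO
  Σψ = OSum (suc (suc n)) ψ
  point : ∀ i → ∣ ψ i ∣
  point i = decidable-stable em (ψ≢0 i)
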